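{- For each $\varepsilon>0$, $$\lim_{d\to\infty}\pi\Big(d,\big\lfloor 2^{(\frac12-\varepsilon)d}\big\rfloor\Big)=1.$$
   Context: Let $X_{d,n}$ be an $n$-element subset of $\{ -1,+1\}^d$ chosen uniformly at random, $P_{d,n}:=\operatorname{conv}X_{d,n}$, and $\{v,w\}$ a two-element subset of $X_{d,n}$ chosen uniformly at random. $\pi(d,n):=\Pr[\{v,w\}\text{ is an edge (one-dimensional face) of }P_{d,n}]$.
   Formalization: The parameter ε ranges over the positive rationals. -}

module Defs where

open import Data.Bool using (Bool; true; false)
open import Data.Nat as ℕ using (ℕ; zero; suc; _^_)
open import Data.Integer using (+_)
open import Data.Rational using (ℚ; 0ℚ; 1ℚ; _+_; _*_; _-_; -_; _<_; _≤_; _/_)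
open import Data.List using (List; []; _∷_; map; concatMap; length)
open import Data.List.Relation.Unary.All using (All)
open import Data.List.Relation.Binary.Sublist.Propositional using (_⊆_)
open import Data.Vec using (Vec; []; _∷_)
open import Data.Product using (_×_; _,_; Σ; ∃)
open import Relation.Binary.PropositionalEquality using (_≡_; _≢_)

-- A point of {-1,+1}^d : true ↦ +1, false ↦ -1.
Point : ℕ → Set
Point d = Vec Bool d

sign : Bool → ℚ
sign true  = 1ℚ
sign false = - 1ℚ

cube : (d : ℕ) → List (Point d)
cube zero    = [] ∷ []
cube (suc d) = map (true ∷_) (cube d) Data.List.++ map (false ∷_) (cube d)

dot : ∀ {d} → Vec ℚ d → Point d → ℚ
dot []       []       = 0ℚ
dot (c ∷ cs) (b ∷ bs) = c * sign b + dot cs bs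

choose : ∀ {A : Set} → ℕ → List A → List (List A)
choose zero    xs       = [] ∷ []
choose (suc k) []       = []
choose (suc k) (x ∷ xs) = map (x ∷_) (choose k xs) Data.List.++ choose (suc k) xs

-- {v,w} is an edge of conv X : v ≠ w and some hyperplane c·x = t supports
-- conv X exactly in the segment [v,w], i.e. c·v = c·w > c·x for all other x ∈ X.
IsEdge : ∀ {d} → List (Point d) → Point d → Point d → Set
IsEdge {d} X v w =
  v ≢ w × Σ (Vec ℚ d) λ c →
    dot c v ≡ dot c w ×
    All (λ x → x ≢ v → x ≢ w → dot c x < dot c v) X

-- Outcomes of the random experiment: an n-subset X of the cube, then a
-- 2-subset {v,w} of X.  Each outcome appears once; all are equally likely;
-- length = C(2^d,n) * C(n,2).
Outcome : ℕ → Set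
Outcome d = List (Point d) × Point d × Point d

pairsOf : ∀ {d} → List (Point d) → List (Outcome d)
pairsOf X = concatMap (λ { (v ∷ w ∷ []) → (X , v , w) ∷ [] ; _ → [] }) (choose 2 X)

outcomes : (d n : ℕ) → List (Outcome d)
outcomes d n = concatMap pairsOf (choose n (cube d))

EdgeOutcome : ∀ {d} → Outcome d → Set
EdgeOutcome (X , v , w) = IsEdge X v w

ℕtoℚ : ℕ → ℚ
ℕtoℚ n = + n / 1

-- π(d,n) ≥ r : there are at least r·|outcomes| outcomes (a sub-list of the
-- duplicate-free outcome list) at which {v,w} is an edge.
πAtLeast : ℕ → ℕ → ℚ → Set
πAtLeast d n r =
  ∃ λ ys → ys ⊆ outcomes d n × All EdgeOutcome ys ×
    r * ℕtoℚ (length (outcomes d n)) ≤ ℕtoℚ (length ys)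

-- n = ⌊ 2^((1/2 - p/q) d) ⌋, i.e. n ≤ 2^((q-2p)d/(2q)) < n+1, written with
-- 2q-th powers (both sides nonnegative) in natural numbers.
IsFloorExp : (p q d n : ℕ) → Set
IsFloorExp p q d n =
  (n ^ (2 ℕ.* q)) ℕ.* 2 ^ ((2 ℕ.* p ℕ.∸ q) ℕ.* d) ℕ.≤ 2 ^ ((q ℕ.∸ 2 ℕ.* p) ℕ.* d) ×
  2 ^ ((q ℕ.∸ 2 ℕ.* p) ℕ.* d) ℕ.< (suc n ^ (2 ℕ.* q)) ℕ.* 2 ^ ((2 ℕ.* p ℕ.∸ q) ℕ.* d)

{-# OPTIONS --safe #-}

-- A pair {v, w} ⊆ X spans an edge of conv X as soon as no third point of X lies in the smallest
-- face of the cube containing v and w, because a linear functional is maximised on the cube exactly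
-- on that face. Call {v, w} far when its Hamming distance h is at least (1 + 1/q) d/2. Since
-- Σ_w (d - 2 h(v, w))² = d 2^d, Chebyshev's inequality makes far pairs a fraction O(q²/d) of all
-- pairs. A near pair spans a face of 2^h ≤ 2^((1 + 1/q) d/2) points, each of which lies in X with
-- probability about n / 2^d ≤ 2^(-(1/2 + p/q) d), so the expected number of third points of X in
-- it is at most 2^((1 - 2p) d/(2q)). Both bounds tend to 0. The probabilities are computed by
-- double counting over the n-subsets X, their pairs and their triples.

module Submission where

open import Defs
open import Data.Nat using (ℕ; zero; suc; _+_; _*_; _∸_; _^_; _≤_; _<_; z≤n; s≤s; z<s; _<?_; _≤ᵇ_; ∣_-_∣;
  NonZero; >-nonZero)
open import Data.Nat.Properties
open import Data.Nat.Combinatorics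
  using (_C_; nCk≡nC[n∸k]; nCn≡1; nC1≡n; k>n⇒nCk≡0; nCk+nC[k+1]≡[n+1]C[k+1])
open import Data.Nat.Tactic.RingSolver using (solve-∀)
open import Algebra.Properties.CommutativeSemigroup +-commutativeSemigroup
  using () renaming (interchange to +-interchange)
open import Data.Bool using (Bool; true; false; not; _∧_; _∨_; _xor_; if_then_else_; T; T?)
open import Data.Bool.Properties using (T-∧; T-∨; T-not-≡; ∧-zeroʳ; ∨-zeroʳ)
open import Data.Bool.ListAction using (all)
open import Data.Vec using (Vec; []; _∷_)
open import Data.List using (List; []; _∷_; _++_; map; concatMap; length; [_]; filterᵇ)
open import Data.List.Properties using (length-++; length-map)
open import Data.List.Relation.Unary.All as All using (All; []; _∷_)
import Data.List.Relation.Unary.All.Properties as All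
open import Data.List.Relation.Binary.Sublist.Propositional.Properties using (filter-⊆)
open import Data.Integer as ℤ using (+[1+_]; -[1+_]) renaming (+_ to pos)
import Data.Integer.Properties as ℤ
open import Data.Nat.Coprimality using (1-coprimeTo) renaming (sym to coprime-sym)
open import Data.Rational using (ℚ; mkℚ; 0ℚ; 1ℚ; _-_)
import Data.Rational as Q
import Data.Rational.Properties as Q
import Data.Rational.Unnormalised as ℚᵘ
import Data.Rational.Unnormalised.Properties as ℚᵘ
open import Data.Rational.Solver using (module +-*-Solver)
open import Data.Product using (_,_; proj₁; proj₂; ∃)
open import Data.Sum using (inj₁; inj₂)
open import Data.Empty using (⊥-elim)
open import Function using (_∘_; Equivalence)
open import Relation.Nullary using (Dec; yes; no; ¬_)
open import Relation.Nullary.Decidable using (True; toWitness)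
open import Relation.Binary.PropositionalEquality hiding ([_])

-- Finite sums

∑ : {A : Set} → List A → (A → ℕ) → ℕ
∑ []       f = 0
∑ (x ∷ xs) f = f x + ∑ xs f

syntax ∑ xs (λ x → e) = ∑[ x ∈ xs ] e

module _ {A : Set} where

  ∑-++ : ∀ (xs ys : List A) f → ∑ (xs ++ ys) f ≡ ∑ xs f + ∑ ys f
  ∑-++ []       ys f = refl
  ∑-++ (x ∷ xs) ys f = trans (cong (f x +_) (∑-++ xs ys f)) (sym (+-assoc (f x) _ _))

  ∑-map : ∀ {B : Set} (g : B → A) xs f → ∑ (map g xs) f ≡ ∑[ x ∈ xs ] f (g x)
  ∑-map g []       f = refl
  ∑-map g (x ∷ xs) f = cong (f (g x) +_) (∑-map g xs f)

  ∑-concatMap : ∀ {B : Set} (g : B → List A) xs f →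
    ∑ (concatMap g xs) f ≡ ∑[ x ∈ xs ] ∑ (g x) f
  ∑-concatMap g []       f = refl
  ∑-concatMap g (x ∷ xs) f =
    trans (∑-++ (g x) (concatMap g xs) f) (cong (∑ (g x) f +_) (∑-concatMap g xs f))

  ∑-cong : ∀ (xs : List A) {f g} → (∀ x → f x ≡ g x) → ∑ xs f ≡ ∑ xs g
  ∑-cong []       f≗g = refl
  ∑-cong (x ∷ xs) f≗g = cong₂ _+_ (f≗g x) (∑-cong xs f≗g)

  ∑-mono-≤ : ∀ (xs : List A) {f g} → (∀ x → f x ≤ g x) → ∑ xs f ≤ ∑ xs g
  ∑-mono-≤ []       f≤g = z≤n
  ∑-mono-≤ (x ∷ xs) f≤g = +-mono-≤ (f≤g x) (∑-mono-≤ xs f≤g)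

  ∑-distrib-+ : ∀ (xs : List A) f g → ∑[ x ∈ xs ] (f x + g x) ≡ ∑ xs f + ∑ xs g
  ∑-distrib-+ []       f g = refl
  ∑-distrib-+ (x ∷ xs) f g =
    trans (cong (f x + g x +_) (∑-distrib-+ xs f g)) (+-interchange (f x) (g x) _ _)

  ∑-*ˡ : ∀ (xs : List A) c f → ∑[ x ∈ xs ] (c * f x) ≡ c * ∑ xs f
  ∑-*ˡ []       c f = sym (*-zeroʳ c)
  ∑-*ˡ (x ∷ xs) c f = trans (cong (c * f x +_) (∑-*ˡ xs c f)) (sym (*-distribˡ-+ c (f x) _))

  ∑-const : ∀ (xs : List A) c → ∑[ x ∈ xs ] c ≡ length xs * c
  ∑-const []       c = refl
  ∑-const (x ∷ xs) c = cong (c +_) (∑-const xs c)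

  ∑-zero : ∀ (xs : List A) {f} → All (λ x → f x ≡ 0) xs → ∑ xs f ≡ 0
  ∑-zero []       []           = refl
  ∑-zero (x ∷ xs) (fx≡0 ∷ f≡0) = cong₂ _+_ fx≡0 (∑-zero xs f≡0)

∑∑-*ˡ : ∀ {A : Set} (xs ys : List A) c (h : A → A → ℕ) →
  ∑[ v ∈ xs ] ∑[ w ∈ ys ] (c * h v w) ≡ c * ∑[ v ∈ xs ] ∑[ w ∈ ys ] h v w
∑∑-*ˡ xs ys c h = trans (∑-cong xs λ v → ∑-*ˡ ys c (h v)) (∑-*ˡ xs c λ v → ∑[ w ∈ ys ] h v w)

𝟙 : Bool → ℕ
𝟙 true  = 1
𝟙 false = 0

𝟙≤1 : ∀ b → 𝟙 b ≤ 1
𝟙≤1 true  = ≤-refl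
𝟙≤1 false = z≤n

𝟙-not-all≤∑ : ∀ {A : Set} (p : A → Bool) xs → 𝟙 (not (all p xs)) ≤ ∑[ x ∈ xs ] 𝟙 (not (p x))
𝟙-not-all≤∑ p []       = z≤n
𝟙-not-all≤∑ p (x ∷ xs) with p x
... | true  = 𝟙-not-all≤∑ p xs
... | false = s≤s z≤n

length-filterᵇ+∑-rejected : ∀ {A : Set} (p : A → Bool) xs →
  length (filterᵇ p xs) + ∑[ x ∈ xs ] 𝟙 (not (p x)) ≡ length xs
length-filterᵇ+∑-rejected p []       = refl
length-filterᵇ+∑-rejected p (x ∷ xs) with p x
... | true  = cong suc (length-filterᵇ+∑-rejected p xs)
... | false = trans (+-suc _ _) (cong suc (length-filterᵇ+∑-rejected p xs))

-- Binomial coefficients and subsets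

nC0≡1 : ∀ n → n C 0 ≡ 1
nC0≡1 n = trans (nCk≡nC[n∸k] {0} {n} z≤n) (nCn≡1 n)

[1+n]C[1+k]*[1+k]≡[1+n]*nCk : ∀ n k → (suc n C suc k) * suc k ≡ suc n * (n C k)
[1+n]C[1+k]*[1+k]≡[1+n]*nCk zero zero = refl
[1+n]C[1+k]*[1+k]≡[1+n]*nCk zero (suc k) =
  trans (cong (_* suc (suc k)) (k>n⇒nCk≡0 {1} {2 + k} (s≤s z<s)))
        (sym (cong (1 *_) (k>n⇒nCk≡0 {0} {suc k} z<s)))
[1+n]C[1+k]*[1+k]≡[1+n]*nCk (suc n) zero = begin
  ((2 + n) C 1) * 1     ≡⟨ *-identityʳ _ ⟩
  (2 + n) C 1           ≡⟨ nC1≡n (2 + n) ⟩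
  2 + n                 ≡⟨ *-identityʳ (2 + n) ⟨
  (2 + n) * 1           ≡⟨ cong ((2 + n) *_) (nC0≡1 (suc n)) ⟨
  (2 + n) * ((1 + n) C 0) ∎
  where open ≡-Reasoning
[1+n]C[1+k]*[1+k]≡[1+n]*nCk (suc n) (suc k) = begin
  ((2 + n) C (2 + k)) * (2 + k)                   ≡⟨ cong (_* (2 + k)) (nCk+nC[k+1]≡[n+1]C[k+1] (suc n) (suc k)) ⟨
  (a + b) * (2 + k)                               ≡⟨ expand a b k ⟩
  a * suc k + a + b * (2 + k)                     ≡⟨ cong₂ (λ x y → x + a + y) ([1+n]C[1+k]*[1+k]≡[1+n]*nCk n k)
                                                                             ([1+n]C[1+k]*[1+k]≡[1+n]*nCk n (suc k)) ⟩
  (1 + n) * (n C k) + a + (1 + n) * (n C (1 + k)) ≡⟨ collect (1 + n) (n C k) (n C (1 + k)) a ⟩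
  a + (1 + n) * (n C k + n C (1 + k))             ≡⟨ cong (λ x → a + (1 + n) * x) (nCk+nC[k+1]≡[n+1]C[k+1] n k) ⟩
  (2 + n) * a                                     ∎
  where
  open ≡-Reasoning
  a = (1 + n) C (1 + k)
  b = (1 + n) C (2 + k)
  expand : ∀ a b k → (a + b) * (2 + k) ≡ a * suc k + a + b * (2 + k)
  expand = solve-∀
  collect : ∀ m x y a → m * x + a + m * y ≡ a + m * (x + y)
  collect = solve-∀

module _ {A : Set} where

  length-choose : ∀ k (xs : List A) → length (choose k xs) ≡ length xs C k
  length-choose zero    xs       = sym (nC0≡1 (length xs))
  length-choose (suc k) []       = sym (k>n⇒nCk≡0 {0} {suc k} z<s)
  length-choose (suc k) (x ∷ xs) = begin
    length (map (x ∷_) (choose k xs) ++ choose (suc k) xs)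
      ≡⟨ length-++ (map (x ∷_) (choose k xs)) ⟩
    length (map (x ∷_) (choose k xs)) + length (choose (suc k) xs)
      ≡⟨ cong₂ _+_ (trans (length-map (x ∷_) (choose k xs)) (length-choose k xs))
                   (length-choose (suc k) xs) ⟩
    length xs C k + length xs C suc k
      ≡⟨ nCk+nC[k+1]≡[n+1]C[k+1] (length xs) k ⟩
    suc (length xs) C suc k ∎
    where open ≡-Reasoning

  choose-≡[] : ∀ k (xs : List A) → length xs < k → choose k xs ≡ []
  choose-≡[] (suc k)       []       _                = refl
  choose-≡[] (suc (suc k)) (x ∷ xs) (s≤s |xs|<1+k) =
    cong₂ (λ ys zs → map (x ∷_) ys ++ zs)
          (choose-≡[] (suc k) xs |xs|<1+k) (choose-≡[] (suc (suc k)) xs (m<n⇒m<1+n |xs|<1+k))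

  All-length-choose : ∀ k (xs : List A) → All (λ ys → length ys ≡ k) (choose k xs)
  All-length-choose zero    xs       = refl ∷ []
  All-length-choose (suc k) []       = []
  All-length-choose (suc k) (x ∷ xs) =
    All.++⁺ (All.map⁺ (All.map (cong suc) (All-length-choose k xs))) (All-length-choose (suc k) xs)

  choose-1 : ∀ (xs : List A) → choose 1 xs ≡ map [_] xs
  choose-1 []       = refl
  choose-1 (x ∷ xs) = cong ([ x ] ∷_) (choose-1 xs)

  m<k⇒∑-choose-choose≡0 : ∀ {m k} → m < k → ∀ (xs : List A) (f : List A → List A → ℕ) →
    ∑[ X ∈ choose m xs ] ∑ (choose k X) (f X) ≡ 0
  m<k⇒∑-choose-choose≡0 {m} {k} m<k xs f = ∑-zero (choose m xs)
    (All.map (λ { refl → cong (λ Ys → ∑ Ys (f _)) (choose-≡[] k _ m<k) }) (All-length-choose m xs))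

  ∑-choose-∷ : ∀ k x (xs : List A) f →
    ∑ (choose (suc k) (x ∷ xs)) f ≡ ∑[ Y ∈ choose k xs ] f (x ∷ Y) + ∑ (choose (suc k) xs) f
  ∑-choose-∷ k x xs f =
    trans (∑-++ (map (x ∷_) (choose k xs)) _ f) (cong (_+ _) (∑-map (x ∷_) (choose k xs) f))

  ∑-choose-choose : ∀ k j (xs : List A) f →
    ∑[ X ∈ choose (k + j) xs ] ∑ (choose k X) f ≡ ((length xs ∸ k) C j) * ∑ (choose k xs) f
  ∑-choose-choose-pascal : ∀ k j (xs : List A) f →
    ∑[ X ∈ choose (k + j) xs ] ∑ (choose (suc k) X) f + ((length xs ∸ suc k) C j) * ∑ (choose (suc k) xs) f
      ≡ ((length xs ∸ k) C j) * ∑ (choose (suc k) xs) f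

  ∑-choose-choose zero    j xs       f =
    trans (∑-const (choose j xs) (f [] + 0)) (cong (_* (f [] + 0)) (length-choose j xs))
  ∑-choose-choose (suc k) j []       f = sym (*-zeroʳ ((0 ∸ suc k) C j))
  ∑-choose-choose (suc k) j (x ∷ xs) f = begin
    ∑ (map (x ∷_) (choose (k + j) xs) ++ choose (suc k + j) xs) F
      ≡⟨ ∑-++ (map (x ∷_) (choose (k + j) xs)) _ F ⟩
    ∑ (map (x ∷_) (choose (k + j) xs)) F + ∑ (choose (suc k + j) xs) F
      ≡⟨ cong₂ _+_ (∑-map (x ∷_) (choose (k + j) xs) F) (∑-choose-choose (suc k) j xs f) ⟩
    ∑[ X ∈ choose (k + j) xs ] F (x ∷ X) + c′ * S
      ≡⟨ cong (_+ c′ * S) (∑-cong (choose (k + j) xs) λ X → ∑-choose-∷ k x X f) ⟩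
    ∑[ X ∈ choose (k + j) xs ] (∑ (choose k X) fₓ + F X) + c′ * S
      ≡⟨ cong (_+ c′ * S) (∑-distrib-+ (choose (k + j) xs) (λ X → ∑ (choose k X) fₓ) F) ⟩
    ∑[ X ∈ choose (k + j) xs ] ∑ (choose k X) fₓ + ∑ (choose (k + j) xs) F + c′ * S
      ≡⟨ cong (λ z → z + ∑ (choose (k + j) xs) F + c′ * S) (∑-choose-choose k j xs fₓ) ⟩
    c * Sₓ + ∑ (choose (k + j) xs) F + c′ * S
      ≡⟨ +-assoc (c * Sₓ) _ _ ⟩
    c * Sₓ + (∑ (choose (k + j) xs) F + c′ * S)
      ≡⟨ cong (c * Sₓ +_) (∑-choose-choose-pascal k j xs f) ⟩
    c * Sₓ + c * S
      ≡⟨ *-distribˡ-+ c Sₓ S ⟨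
    c * (Sₓ + S)
      ≡⟨ cong (c *_) (∑-choose-∷ k x xs f) ⟨
    c * ∑ (choose (suc k) (x ∷ xs)) f ∎
    where
    open ≡-Reasoning
    c = (length xs ∸ k) C j
    c′ = (length xs ∸ suc k) C j
    F = λ X → ∑ (choose (suc k) X) f
    fₓ = λ Y → f (x ∷ Y)
    S = ∑ (choose (suc k) xs) f
    Sₓ = ∑ (choose k xs) fₓ

  ∑-choose-choose-pascal k zero    xs f = cong₂ _+_
    (m<k⇒∑-choose-choose≡0 (s≤s (≤-reflexive (+-identityʳ k))) xs (λ _ → f))
    (trans (cong (_* ∑ (choose (suc k) xs) f) (nC0≡1 (length xs ∸ suc k)))
           (sym (cong (_* ∑ (choose (suc k) xs) f) (nC0≡1 (length xs ∸ k)))))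
  ∑-choose-choose-pascal k (suc i) xs f = begin
    ∑ (choose (k + suc i) xs) F + (m C suc i) * S
      ≡⟨ cong (λ r → ∑ (choose r xs) F + (m C suc i) * S) (+-suc k i) ⟩
    ∑ (choose (suc k + i) xs) F + (m C suc i) * S
      ≡⟨ cong (_+ (m C suc i) * S) (∑-choose-choose (suc k) i xs f) ⟩
    (m C i) * S + (m C suc i) * S
      ≡⟨ *-distribʳ-+ S (m C i) (m C suc i) ⟨
    ((m C i) + (m C suc i)) * S
      ≡⟨ pascal (k <? length xs) ⟩
    ((length xs ∸ k) C suc i) * S ∎
    where
    open ≡-Reasoning
    m = length xs ∸ suc k
    F = λ X → ∑ (choose (suc k) X) f
    S = ∑ (choose (suc k) xs) f
    pascal : Dec (k < length xs) → ((m C i) + (m C suc i)) * S ≡ ((length xs ∸ k) C suc i) * S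
    pascal (yes k<ℓ) =
      cong (_* S) (trans (nCk+nC[k+1]≡[n+1]C[k+1] m i) (cong (_C suc i) (sym (+-∸-assoc 1 k<ℓ))))
    pascal (no k≮ℓ) rewrite choose-≡[] (suc k) xs (s≤s (≮⇒≥ k≮ℓ)) =
      trans (*-zeroʳ ((m C i) + (m C suc i))) (sym (*-zeroʳ ((length xs ∸ k) C suc i)))

pairSum : {A : Set} → (A → A → ℕ) → List A → ℕ
pairSum h (v ∷ w ∷ []) = h v w
pairSum h _            = 0

tripleSum : {A : Set} → (A → A → A → ℕ) → List A → ℕ
tripleSum g (a ∷ b ∷ c ∷ []) = g a b c + g a c b + g b c a
tripleSum g _                = 0

module _ {A : Set} where

  ∑-choose-2-∷ : ∀ x (xs : List A) f →
    ∑ (choose 2 (x ∷ xs)) f ≡ ∑[ y ∈ xs ] f (x ∷ y ∷ []) + ∑ (choose 2 xs) f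
  ∑-choose-2-∷ x xs f = trans (∑-choose-∷ 1 x xs f)
    (cong (_+ ∑ (choose 2 xs) f) (trans (cong (λ Ys → ∑ Ys (λ Y → f (x ∷ Y))) (choose-1 xs))
                                        (∑-map [_] xs (λ Y → f (x ∷ Y)))))

  ∑∑≡∑-pairs+∑-diagonal : ∀ (h : A → A → ℕ) xs →
    ∑[ y ∈ xs ] ∑[ x ∈ xs ] h y x ≡ ∑ (choose 2 xs) (pairSum λ v w → h v w + h w v) + ∑[ y ∈ xs ] h y y
  ∑∑≡∑-pairs+∑-diagonal h []       = refl
  ∑∑≡∑-pairs+∑-diagonal h (e ∷ xs) = begin
    (h e e + ∑ xs (h e)) + ∑[ y ∈ xs ] (h y e + ∑ xs (h y))
      ≡⟨ cong ((h e e + ∑ xs (h e)) +_) (∑-distrib-+ xs (λ y → h y e) (λ y → ∑ xs (h y))) ⟩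
    (h e e + ∑ xs (h e)) + (∑[ y ∈ xs ] h y e + ∑[ y ∈ xs ] ∑ xs (h y))
      ≡⟨ cong (λ z → (h e e + ∑ xs (h e)) + (∑[ y ∈ xs ] h y e + z)) (∑∑≡∑-pairs+∑-diagonal h xs) ⟩
    (h e e + ∑ xs (h e)) + (∑[ y ∈ xs ] h y e + (P + D))
      ≡⟨ regroup (h e e) (∑ xs (h e)) (∑[ y ∈ xs ] h y e) P D ⟩
    (∑ xs (h e) + ∑[ y ∈ xs ] h y e) + P + (h e e + D)
      ≡⟨ cong (λ z → z + P + (h e e + D)) (∑-distrib-+ xs (h e) (λ y → h y e)) ⟨
    ∑[ y ∈ xs ] H e y + P + (h e e + D)
      ≡⟨ cong (_+ (h e e + D)) (∑-choose-2-∷ e xs (pairSum H)) ⟨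
    ∑ (choose 2 (e ∷ xs)) (pairSum H) + (h e e + D) ∎
    where
    open ≡-Reasoning
    H = λ v w → h v w + h w v
    P = ∑ (choose 2 xs) (pairSum H)
    D = ∑[ y ∈ xs ] h y y
    regroup : ∀ a b c p d → (a + b) + (c + (p + d)) ≡ (b + c) + p + (a + d)
    regroup = solve-∀

  ∑-pairs-∑-points≡∑-triples : ∀ (g : A → A → A → ℕ) →
    (∀ a b → g a b a ≡ 0) → (∀ a b → g a b b ≡ 0) → ∀ xs →
    ∑[ Y ∈ choose 2 xs ] ∑[ x ∈ xs ] pairSum (λ v w → g v w x) Y ≡ ∑ (choose 3 xs) (tripleSum g)
  ∑-pairs-∑-points≡∑-triples g gvwv≡0 gvww≡0 []       = refl
  ∑-pairs-∑-points≡∑-triples g gvwv≡0 gvww≡0 (a ∷ xs) = begin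
    ∑[ Y ∈ choose 2 (a ∷ xs) ] (gₓ Y a + ∑ xs (gₓ Y))
      ≡⟨ ∑-choose-2-∷ a xs (λ Y → gₓ Y a + ∑ xs (gₓ Y)) ⟩
    ∑[ y ∈ xs ] (g a y a + ∑ xs (g a y)) + ∑[ Y ∈ choose 2 xs ] (gₓ Y a + ∑ xs (gₓ Y))
      ≡⟨ cong₂ _+_ (∑-cong xs λ y → cong (_+ ∑ xs (g a y)) (gvwv≡0 a y))
                   (∑-distrib-+ (choose 2 xs) (λ Y → gₓ Y a) (λ Y → ∑ xs (gₓ Y))) ⟩
    ∑[ y ∈ xs ] ∑ xs (g a y) + (∑[ Y ∈ choose 2 xs ] gₓ Y a + ∑[ Y ∈ choose 2 xs ] ∑ xs (gₓ Y))
      ≡⟨ cong₂ (λ u z → u + (∑[ Y ∈ choose 2 xs ] gₓ Y a + z))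
               (∑∑≡∑-pairs+∑-diagonal (g a) xs) (∑-pairs-∑-points≡∑-triples g gvwv≡0 gvww≡0 xs) ⟩
    (Pₐ + ∑[ y ∈ xs ] g a y y) + (∑[ Y ∈ choose 2 xs ] gₓ Y a + T₃)
      ≡⟨ cong (λ z → (Pₐ + z) + (∑[ Y ∈ choose 2 xs ] gₓ Y a + T₃))
              (∑-zero xs (All.tabulate λ {y} _ → gvww≡0 a y)) ⟩
    (Pₐ + 0) + (∑[ Y ∈ choose 2 xs ] gₓ Y a + T₃)
      ≡⟨ regroup Pₐ _ T₃ ⟩
    (Pₐ + ∑[ Y ∈ choose 2 xs ] gₓ Y a) + T₃
      ≡⟨ cong (_+ T₃) (∑-distrib-+ (choose 2 xs) (pairSum (λ v w → g a v w + g a w v)) (λ Y → gₓ Y a)) ⟨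
    ∑[ Y ∈ choose 2 xs ] (pairSum (λ v w → g a v w + g a w v) Y + gₓ Y a) + T₃
      ≡⟨ cong (_+ T₃) (∑-cong (choose 2 xs) tripleSum-∷) ⟨
    ∑[ Y ∈ choose 2 xs ] tripleSum g (a ∷ Y) + T₃
      ≡⟨ ∑-choose-∷ 2 a xs (tripleSum g) ⟨
    ∑ (choose 3 (a ∷ xs)) (tripleSum g) ∎
    where
    open ≡-Reasoning
    gₓ = λ Y x → pairSum (λ v w → g v w x) Y
    Pₐ = ∑ (choose 2 xs) (pairSum λ v w → g a v w + g a w v)
    T₃ = ∑ (choose 3 xs) (tripleSum g)
    regroup : ∀ p q t → (p + 0) + (q + t) ≡ (p + q) + t
    regroup = solve-∀
    tripleSum-∷ : ∀ Y → tripleSum g (a ∷ Y) ≡ pairSum (λ v w → g a v w + g a w v) Y + gₓ Y a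
    tripleSum-∷ []               = refl
    tripleSum-∷ (b ∷ [])         = refl
    tripleSum-∷ (b ∷ c ∷ [])     = refl
    tripleSum-∷ (b ∷ c ∷ d ∷ Y) = refl

∑-pairs≤∑∑ : ∀ {A : Set} (h : A → A → ℕ) xs →
  ∑ (choose 2 xs) (pairSum h) ≤ ∑[ v ∈ xs ] ∑[ w ∈ xs ] h v w
∑-pairs≤∑∑ h xs = begin
  ∑ (choose 2 xs) (pairSum h)
    ≤⟨ ∑-mono-≤ (choose 2 xs) h≤h+hᵀ ⟩
  ∑ (choose 2 xs) (pairSum λ v w → h v w + h w v)
    ≤⟨ m≤m+n _ _ ⟩
  ∑ (choose 2 xs) (pairSum λ v w → h v w + h w v) + ∑[ v ∈ xs ] h v v
    ≡⟨ ∑∑≡∑-pairs+∑-diagonal h xs ⟨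
  ∑[ v ∈ xs ] ∑[ w ∈ xs ] h v w ∎
  where
  open ≤-Reasoning
  h≤h+hᵀ : ∀ Y → pairSum h Y ≤ pairSum (λ v w → h v w + h w v) Y
  h≤h+hᵀ []              = z≤n
  h≤h+hᵀ (v ∷ [])        = z≤n
  h≤h+hᵀ (v ∷ w ∷ [])    = m≤m+n _ _
  h≤h+hᵀ (v ∷ w ∷ _ ∷ _) = z≤n

-- The cube

infix 7 _==_
_==_ : ∀ {d} → Point d → Point d → Bool
[]      == []      = true
(a ∷ v) == (b ∷ w) = not (a xor b) ∧ v == w

==-refl : ∀ {d} (v : Point d) → v == v ≡ true
==-refl []          = refl
==-refl (true ∷ v)  = ==-refl v
==-refl (false ∷ v) = ==-refl v

==⇒≡ : ∀ {d} {v w : Point d} → T (v == w) → v ≡ w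
==⇒≡ {v = []}        {[]}        _    = refl
==⇒≡ {v = true ∷ v}  {true ∷ w}  v==w = cong (true ∷_) (==⇒≡ v==w)
==⇒≡ {v = false ∷ v} {false ∷ w} v==w = cong (false ∷_) (==⇒≡ v==w)

agreements hamming : ∀ {d} → Point d → Point d → ℕ
agreements []      []      = 0
agreements (a ∷ v) (b ∷ w) = 𝟙 (not (a xor b)) + agreements v w
hamming    []      []      = 0
hamming    (a ∷ v) (b ∷ w) = 𝟙 (a xor b) + hamming v w

inFace : ∀ {d} → Point d → Point d → Point d → Bool
inFace []      []      []      = true
inFace (a ∷ v) (b ∷ w) (c ∷ x) = ((a xor b) ∨ not (a xor c)) ∧ inFace v w x

agreements+hamming≡d : ∀ {d} (v w : Point d) → agreements v w + hamming v w ≡ d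
agreements+hamming≡d []      []      = refl
agreements+hamming≡d (a ∷ v) (b ∷ w) = begin
  𝟙 (not (a xor b)) + agreements v w + (𝟙 (a xor b) + hamming v w)
    ≡⟨ +-interchange (𝟙 (not (a xor b))) (agreements v w) (𝟙 (a xor b)) (hamming v w) ⟩
  𝟙 (not (a xor b)) + 𝟙 (a xor b) + (agreements v w + hamming v w)
    ≡⟨ cong₂ _+_ (𝟙-not+𝟙 (a xor b)) (agreements+hamming≡d v w) ⟩
  suc _ ∎
  where
  open ≡-Reasoning
  𝟙-not+𝟙 : ∀ c → 𝟙 (not c) + 𝟙 c ≡ 1
  𝟙-not+𝟙 true  = refl
  𝟙-not+𝟙 false = refl

length-cube : ∀ d → length (cube d) ≡ 2 ^ d
length-cube zero    = refl
length-cube (suc d) = begin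
  length (map (true ∷_) (cube d) ++ map (false ∷_) (cube d))
    ≡⟨ length-++ (map (true ∷_) (cube d)) ⟩
  length (map (true ∷_) (cube d)) + length (map (false ∷_) (cube d))
    ≡⟨ cong₂ _+_ (length-map (true ∷_) (cube d)) (length-map (false ∷_) (cube d)) ⟩
  length (cube d) + length (cube d)
    ≡⟨ cong (λ n → n + n) (length-cube d) ⟩
  2 ^ d + 2 ^ d
    ≡⟨ cong (2 ^ d +_) (+-identityʳ (2 ^ d)) ⟨
  2 ^ suc d ∎
  where open ≡-Reasoning

∑-cube-suc : ∀ d (f : Point (suc d) → ℕ) →
  ∑ (cube (suc d)) f ≡ ∑[ x ∈ cube d ] f (true ∷ x) + ∑[ x ∈ cube d ] f (false ∷ x)
∑-cube-suc d f = trans (∑-++ (map (true ∷_) (cube d)) (map (false ∷_) (cube d)) f)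
  (cong₂ _+_ (∑-map (true ∷_) (cube d) f) (∑-map (false ∷_) (cube d) f))

∑-cube-const : ∀ d c → ∑[ x ∈ cube d ] c ≡ 2 ^ d * c
∑-cube-const d c = trans (∑-const (cube d) c) (cong (_* c) (length-cube d))

∑-cube-zero : ∀ d → ∑[ x ∈ cube d ] 0 ≡ 0
∑-cube-zero d = trans (∑-cube-const d 0) (*-zeroʳ (2 ^ d))

∑-cube-𝟙[x==v] : ∀ d (v : Point d) → ∑[ x ∈ cube d ] 𝟙 (x == v) ≡ 1
∑-cube-𝟙[x==v] zero    []          = refl
∑-cube-𝟙[x==v] (suc d) (true ∷ v)  =
  trans (∑-cube-suc d _) (cong₂ _+_ (∑-cube-𝟙[x==v] d v) (∑-cube-zero d))
∑-cube-𝟙[x==v] (suc d) (false ∷ v) =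
  trans (∑-cube-suc d _) (cong₂ _+_ (∑-cube-zero d) (∑-cube-𝟙[x==v] d v))

∣[1+x]-y∣²+∣x-[1+y]∣²≡2∣x-y∣²+2 : ∀ x y →
  ∣ suc x - y ∣ ^ 2 + ∣ x - suc y ∣ ^ 2 ≡ 2 * ∣ x - y ∣ ^ 2 + 2
∣[1+x]-y∣²+∣x-[1+y]∣²≡2∣x-y∣²+2 zero    zero    = refl
∣[1+x]-y∣²+∣x-[1+y]∣²≡2∣x-y∣²+2 zero    (suc y) = expand y
  where
  expand : ∀ y → y * (y * 1) + (2 + y) * ((2 + y) * 1) ≡ 2 * ((1 + y) * ((1 + y) * 1)) + 2
  expand = solve-∀
∣[1+x]-y∣²+∣x-[1+y]∣²≡2∣x-y∣²+2 (suc x) zero    =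
  trans (cong (λ z → (2 + x) ^ 2 + z ^ 2) (∣-∣-identityʳ x)) (expand x)
  where
  expand : ∀ x → (2 + x) * ((2 + x) * 1) + x * (x * 1) ≡ 2 * ((1 + x) * ((1 + x) * 1)) + 2
  expand = solve-∀
∣[1+x]-y∣²+∣x-[1+y]∣²≡2∣x-y∣²+2 (suc x) (suc y) = ∣[1+x]-y∣²+∣x-[1+y]∣²≡2∣x-y∣²+2 x y

∑-cube-∣agreements-hamming∣² : ∀ d (v : Point d) →
  ∑[ w ∈ cube d ] (∣ agreements v w - hamming v w ∣ ^ 2) ≡ d * 2 ^ d
∑-cube-∣agreements-hamming∣² zero    []      = refl
∑-cube-∣agreements-hamming∣² (suc d) (a ∷ v) = begin
  ∑ (cube (suc d)) F
    ≡⟨ ∑-cube-suc d F ⟩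
  ∑[ w ∈ cube d ] F (true ∷ w) + ∑[ w ∈ cube d ] F (false ∷ w)
    ≡⟨ ∑-distrib-+ (cube d) _ _ ⟨
  ∑[ w ∈ cube d ] (F (true ∷ w) + F (false ∷ w))
    ≡⟨ ∑-cong (cube d) (coordinate a) ⟩
  ∑[ w ∈ cube d ] (2 * ∣ agreements v w - hamming v w ∣ ^ 2 + 2)
    ≡⟨ ∑-distrib-+ (cube d) _ _ ⟩
  ∑[ w ∈ cube d ] (2 * ∣ agreements v w - hamming v w ∣ ^ 2) + ∑[ w ∈ cube d ] 2
    ≡⟨ cong₂ _+_ (trans (∑-*ˡ (cube d) 2 _) (cong (2 *_) (∑-cube-∣agreements-hamming∣² d v)))
                 (∑-cube-const d 2) ⟩
  2 * (d * 2 ^ d) + 2 ^ d * 2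
    ≡⟨ collect d (2 ^ d) ⟩
  suc d * 2 ^ suc d ∎
  where
  open ≡-Reasoning
  F = λ w → ∣ agreements (a ∷ v) w - hamming (a ∷ v) w ∣ ^ 2
  collect : ∀ d N → 2 * (d * N) + N * 2 ≡ suc d * (2 * N)
  collect = solve-∀
  coordinate : ∀ a w → ∣ agreements (a ∷ v) (true ∷ w) - hamming (a ∷ v) (true ∷ w) ∣ ^ 2
                     + ∣ agreements (a ∷ v) (false ∷ w) - hamming (a ∷ v) (false ∷ w) ∣ ^ 2
                     ≡ 2 * ∣ agreements v w - hamming v w ∣ ^ 2 + 2
  coordinate true  w = ∣[1+x]-y∣²+∣x-[1+y]∣²≡2∣x-y∣²+2 (agreements v w) (hamming v w)
  coordinate false w = trans (+-comm (∣ agreements v w - suc (hamming v w) ∣ ^ 2) _)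
                             (∣[1+x]-y∣²+∣x-[1+y]∣²≡2∣x-y∣²+2 (agreements v w) (hamming v w))

∑-cube-inFace : ∀ d (v w : Point d) → ∑[ x ∈ cube d ] 𝟙 (inFace v w x) ≡ 2 ^ hamming v w
∑-cube-inFace zero    []      []      = refl
∑-cube-inFace (suc d) (a ∷ v) (b ∷ w) = trans (∑-cube-suc d _) (coordinate a b)
  where
  I = ∑[ x ∈ cube d ] 𝟙 (inFace v w x)
  I≡2^h : I ≡ 2 ^ hamming v w
  I≡2^h = ∑-cube-inFace d v w
  coordinate : ∀ a b → ∑[ x ∈ cube d ] 𝟙 (inFace (a ∷ v) (b ∷ w) (true ∷ x))
                     + ∑[ x ∈ cube d ] 𝟙 (inFace (a ∷ v) (b ∷ w) (false ∷ x))
                     ≡ 2 ^ hamming (a ∷ v) (b ∷ w)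
  coordinate true  true  = trans (cong₂ _+_ I≡2^h (∑-cube-zero d)) (+-identityʳ _)
  coordinate false false = cong₂ _+_ (∑-cube-zero d) I≡2^h
  coordinate true  false = trans (cong₂ _+_ I≡2^h I≡2^h) (cong (2 ^ hamming v w +_) (sym (+-identityʳ _)))
  coordinate false true  = trans (cong₂ _+_ I≡2^h I≡2^h) (cong (2 ^ hamming v w +_) (sym (+-identityʳ _)))

-- Faces and edges

normal : ∀ {d} → Point d → Point d → Vec ℚ d
normal []      []      = []
normal (a ∷ v) (b ∷ w) = (if a xor b then 0ℚ else sign a) ∷ normal v w

private
  decide-≤ : {p q : ℚ} → {True (p Q.≤? q)} → p Q.≤ q
  decide-≤ {p} {q} {p≤q} = toWitness p≤q

  decide-< : {p q : ℚ} → {True (p Q.<? q)} → p Q.< q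
  decide-< {p} {q} {p<q} = toWitness p<q

  normalTerm : Bool → Bool → Bool → ℚ
  normalTerm a b c = (if a xor b then 0ℚ else sign a) Q.* sign c

  normalTerm-≤ : ∀ a b c → normalTerm a b c Q.≤ normalTerm a b a
  normalTerm-≤ true  true  true  = decide-≤
  normalTerm-≤ true  true  false = decide-≤
  normalTerm-≤ true  false true  = decide-≤
  normalTerm-≤ true  false false = decide-≤
  normalTerm-≤ false true  true  = decide-≤
  normalTerm-≤ false true  false = decide-≤
  normalTerm-≤ false false true  = decide-≤
  normalTerm-≤ false false false = decide-≤

  normalTerm-< : ∀ a b c → ((a xor b) ∨ not (a xor c)) ≡ false → normalTerm a b c Q.< normalTerm a b a
  normalTerm-< true  true  false _ = decide-<
  normalTerm-< false false true  _ = decide-<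

  normalTerm-a≡b : ∀ a b → normalTerm a b a ≡ normalTerm a b b
  normalTerm-a≡b true  true  = refl
  normalTerm-a≡b true  false = refl
  normalTerm-a≡b false true  = refl
  normalTerm-a≡b false false = refl

dot-normal-≡ : ∀ {d} (v w : Point d) → dot (normal v w) v ≡ dot (normal v w) w
dot-normal-≡ []      []      = refl
dot-normal-≡ (a ∷ v) (b ∷ w) = cong₂ Q._+_ (normalTerm-a≡b a b) (dot-normal-≡ v w)

dot-normal-≤ : ∀ {d} (v w x : Point d) → dot (normal v w) x Q.≤ dot (normal v w) v
dot-normal-≤ []      []      []      = Q.≤-refl
dot-normal-≤ (a ∷ v) (b ∷ w) (c ∷ x) = Q.+-mono-≤ (normalTerm-≤ a b c) (dot-normal-≤ v w x)

dot-normal-< : ∀ {d} (v w x : Point d) → inFace v w x ≡ false →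
  dot (normal v w) x Q.< dot (normal v w) v
dot-normal-< []      []      []      ()
dot-normal-< (a ∷ v) (b ∷ w) (c ∷ x) outside with (a xor b) ∨ not (a xor c) in aₓ
... | false = Q.+-mono-<-≤ (normalTerm-< a b c aₓ) (dot-normal-≤ v w x)
... | true  = Q.+-mono-≤-< (normalTerm-≤ a b c) (dot-normal-< v w x outside)

faceFree⇒IsEdge : ∀ {d} {X : List (Point d)} {v w} → v ≢ w →
  All (λ x → x ≢ v → x ≢ w → inFace v w x ≡ false) X → IsEdge X v w
faceFree⇒IsEdge {v = v} {w} v≢w faceFree =
  v≢w , normal v w , dot-normal-≡ v w ,
  All.map (λ outside x≢v x≢w → dot-normal-< v w _ (outside x≢v x≢w)) faceFree

separated : ∀ {d} → Point d → Point d → Point d → Bool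
separated v w x = x == v ∨ x == w ∨ not (inFace v w x)

isGood : ∀ {d} → Outcome d → Bool
isGood (X , v , w) = not (v == w) ∧ all (separated v w) X

isGood⇒EdgeOutcome : ∀ {d} (o : Outcome d) → T (isGood o) → EdgeOutcome o
isGood⇒EdgeOutcome (X , v , w) good =
  faceFree⇒IsEdge v≢w (All.map outside (All.all⁺ (separated v w) X allSeparated))
  where
  v≠w = proj₁ (Equivalence.to (T-∧ {not (v == w)}) good)
  allSeparated = proj₂ (Equivalence.to (T-∧ {not (v == w)}) good)
  v≢w : v ≢ w
  v≢w refl = subst (T ∘ not) (==-refl v) v≠w
  outside : ∀ {x} → T (separated v w x) → x ≢ v → x ≢ w → inFace v w x ≡ false
  outside sep x≢v x≢w with Equivalence.to T-∨ sep
  ... | inj₁ x==v = ⊥-elim (x≢v (==⇒≡ x==v))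
  ... | inj₂ sep′ with Equivalence.to T-∨ sep′
  ...   | inj₁ x==w    = ⊥-elim (x≢w (==⇒≡ x==w))
  ...   | inj₂ ¬inFace = Equivalence.to T-not-≡ ¬inFace

-- Counting bad outcomes

-- The ordered pairs with w == v number 2^d, and the diagonal alone already accounts for all of them.
∑-pairs-cube-𝟙[v==w]≡0 : ∀ d → ∑ (choose 2 (cube d)) (pairSum λ v w → 𝟙 (v == w)) ≡ 0
∑-pairs-cube-𝟙[v==w]≡0 d = n≤0⇒n≡0 (≤-trans (∑-mono-≤ (choose 2 Qᵈ) ==≤==+==ᵀ)
                                            (≤-reflexive (+-cancelʳ-≡ N P 0 P+N≡N)))
  where
  open ≡-Reasoning
  Qᵈ = cube d
  N = ∑[ v ∈ Qᵈ ] 1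
  P = ∑ (choose 2 Qᵈ) (pairSum λ v w → 𝟙 (w == v) + 𝟙 (v == w))
  ==≤==+==ᵀ : ∀ Y → pairSum (λ v w → 𝟙 (v == w)) Y ≤ pairSum (λ v w → 𝟙 (w == v) + 𝟙 (v == w)) Y
  ==≤==+==ᵀ []              = z≤n
  ==≤==+==ᵀ (v ∷ [])        = z≤n
  ==≤==+==ᵀ (v ∷ w ∷ [])    = m≤n+m _ _
  ==≤==+==ᵀ (v ∷ w ∷ _ ∷ _) = z≤n
  P+N≡N : P + N ≡ N
  P+N≡N = begin
    P + N                             ≡⟨ cong (P +_) (∑-cong Qᵈ (λ v → cong 𝟙 (==-refl v))) ⟨
    P + ∑[ v ∈ Qᵈ ] 𝟙 (v == v)        ≡⟨ ∑∑≡∑-pairs+∑-diagonal (λ v w → 𝟙 (w == v)) Qᵈ ⟨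
    ∑[ v ∈ Qᵈ ] ∑[ w ∈ Qᵈ ] 𝟙 (w == v) ≡⟨ ∑-cong Qᵈ (∑-cube-𝟙[x==v] d) ⟩
    N                                 ∎

∑-outcomes : ∀ d n (f : Outcome d → ℕ) →
  ∑ (outcomes d n) f ≡ ∑[ X ∈ choose n (cube d) ] ∑ (choose 2 X) (pairSum λ v w → f (X , v , w))
∑-outcomes d n f = trans (∑-concatMap pairsOf (choose n (cube d)) f) (∑-cong (choose n (cube d)) λ X →
  trans (∑-concatMap _ (choose 2 X) f) (∑-cong (choose 2 X)
    λ { [] → refl ; (v ∷ []) → refl ; (v ∷ w ∷ []) → +-identityʳ _ ; (v ∷ w ∷ _ ∷ _) → refl }))

badCount : ℕ → ℕ → ℕ
badCount d n = ∑[ o ∈ outcomes d n ] 𝟙 (not (isGood o))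

far : ℕ → ∀ {d} → Point d → Point d → Bool
far q {d} v w = d + q * agreements v w ≤ᵇ q * hamming v w

blocks : ℕ → ∀ {d} → Point d → Point d → Point d → ℕ
blocks q v w x = 𝟙 (not (far q v w) ∧ not (separated v w x))

blocks-v≡0 : ∀ q {d} (v w : Point d) → blocks q v w v ≡ 0
blocks-v≡0 q v w rewrite ==-refl v = cong 𝟙 (∧-zeroʳ (not (far q v w)))

blocks-w≡0 : ∀ q {d} (v w : Point d) → blocks q v w w ≡ 0
blocks-w≡0 q v w rewrite ==-refl w | ∨-zeroʳ (w == v) = cong 𝟙 (∧-zeroʳ (not (far q v w)))

𝟙-bad≤ : ∀ q {d} X (v w : Point d) →
  𝟙 (not (isGood (X , v , w))) ≤ 𝟙 (v == w) + 𝟙 (far q v w) + ∑[ x ∈ X ] blocks q v w x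
𝟙-bad≤ q X v w with v == w
... | true  = s≤s z≤n
... | false with far q v w
...   | true  = ≤-trans (𝟙≤1 _) (m≤m+n 1 _)
...   | false = 𝟙-not-all≤∑ (separated v w) X

∑-pairs-bad≤ : ∀ q {d} (X : List (Point d)) →
  ∑ (choose 2 X) (pairSum λ v w → 𝟙 (not (isGood (X , v , w)))) ≤
  ∑ (choose 2 X) (pairSum λ v w → 𝟙 (v == w)) + ∑ (choose 2 X) (pairSum λ v w → 𝟙 (far q v w))
    + ∑ (choose 3 X) (tripleSum (blocks q))
∑-pairs-bad≤ q X = begin
  ∑ (choose 2 X) (pairSum λ v w → 𝟙 (not (isGood (X , v , w))))
    ≤⟨ ∑-mono-≤ (choose 2 X) bad≤ ⟩
  ∑[ Y ∈ choose 2 X ] (E Y + F Y + B Y)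
    ≡⟨ ∑-distrib-+ (choose 2 X) (λ Y → E Y + F Y) B ⟩
  ∑[ Y ∈ choose 2 X ] (E Y + F Y) + ∑ (choose 2 X) B
    ≡⟨ cong₂ _+_ (∑-distrib-+ (choose 2 X) E F)
                 (∑-pairs-∑-points≡∑-triples (blocks q) (blocks-v≡0 q) (blocks-w≡0 q) X) ⟩
  ∑ (choose 2 X) E + ∑ (choose 2 X) F + ∑ (choose 3 X) (tripleSum (blocks q)) ∎
  where
  open ≤-Reasoning
  E = pairSum λ v w → 𝟙 (v == w)
  F = pairSum λ v w → 𝟙 (far q v w)
  B = λ Y → ∑[ x ∈ X ] pairSum (λ v w → blocks q v w x) Y
  bad≤ : ∀ Y → pairSum (λ v w → 𝟙 (not (isGood (X , v , w)))) Y ≤ E Y + F Y + B Y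
  bad≤ []              = z≤n
  bad≤ (v ∷ [])        = z≤n
  bad≤ (v ∷ w ∷ [])    = 𝟙-bad≤ q X v w
  bad≤ (v ∷ w ∷ _ ∷ _) = z≤n

pairs : ℕ → ℕ
pairs d = ∑ (choose 2 (cube d)) (pairSum λ _ _ → 1)

farPairs : ℕ → ℕ → ℕ
farPairs q d = ∑[ v ∈ cube d ] ∑[ w ∈ cube d ] 𝟙 (far q v w)

blockings : ℕ → ℕ → ℕ
blockings q d = ∑[ v ∈ cube d ] ∑[ w ∈ cube d ] ∑[ x ∈ cube d ] blocks q v w x

∑-choose-choose-cube : ∀ k j d f →
  ∑[ X ∈ choose (k + j) (cube d) ] ∑ (choose k X) f ≡ ((2 ^ d ∸ k) C j) * ∑ (choose k (cube d)) f
∑-choose-choose-cube k j d f =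
  trans (∑-choose-choose k j (cube d) f) (cong (λ N → ((N ∸ k) C j) * ∑ (choose k (cube d)) f) (length-cube d))

2*pairs+2^d≡2^d*2^d : ∀ d → 2 * pairs d + 2 ^ d ≡ 2 ^ d * 2 ^ d
2*pairs+2^d≡2^d*2^d d = begin
  2 * pairs d + 2 ^ d
    ≡⟨ cong₂ _+_ (∑-*ˡ (choose 2 (cube d)) 2 _) ∑1≡2^d ⟨
  ∑[ Y ∈ choose 2 (cube d) ] (2 * pairSum (λ _ _ → 1) Y) + ∑[ v ∈ cube d ] 1
    ≡⟨ cong (_+ ∑[ v ∈ cube d ] 1) (∑-cong (choose 2 (cube d)) double) ⟨
  ∑ (choose 2 (cube d)) (pairSum λ _ _ → 2) + ∑[ v ∈ cube d ] 1
    ≡⟨ ∑∑≡∑-pairs+∑-diagonal (λ _ _ → 1) (cube d) ⟨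
  ∑[ v ∈ cube d ] ∑[ w ∈ cube d ] 1
    ≡⟨ trans (∑-cong (cube d) λ _ → ∑1≡2^d) (∑-cube-const d (2 ^ d)) ⟩
  2 ^ d * 2 ^ d ∎
  where
  open ≡-Reasoning
  ∑1≡2^d : ∑[ v ∈ cube d ] 1 ≡ 2 ^ d
  ∑1≡2^d = trans (∑-cube-const d 1) (*-identityʳ (2 ^ d))
  double : ∀ Y → pairSum (λ _ _ → 2) Y ≡ 2 * pairSum (λ _ _ → 1) Y
  double []              = refl
  double (v ∷ [])        = refl
  double (v ∷ w ∷ [])    = refl
  double (v ∷ w ∷ _ ∷ _) = refl

length-outcomes : ∀ d j → length (outcomes d (2 + j)) ≡ ((2 ^ d ∸ 2) C j) * pairs d
length-outcomes d j = begin
  length (outcomes d (2 + j))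
    ≡⟨ trans (∑-const (outcomes d (2 + j)) 1) (*-identityʳ _) ⟨
  ∑[ o ∈ outcomes d (2 + j) ] 1
    ≡⟨ ∑-outcomes d (2 + j) (λ _ → 1) ⟩
  ∑[ X ∈ choose (2 + j) (cube d) ] ∑ (choose 2 X) (pairSum λ _ _ → 1)
    ≡⟨ ∑-choose-choose-cube 2 j d (pairSum λ _ _ → 1) ⟩
  ((2 ^ d ∸ 2) C j) * pairs d ∎
  where open ≡-Reasoning

badCount-<2 : ∀ {n} d → n < 2 → badCount d n ≡ 0
badCount-<2 {n} d n<2 = trans (∑-outcomes d n _) (m<k⇒∑-choose-choose≡0 n<2 (cube d) _)

badCount-≤ : ∀ q d j → badCount d (2 + j) ≤
  ((2 ^ d ∸ 2) C j) * farPairs q d + ∑[ X ∈ choose (2 + j) (cube d) ] ∑ (choose 3 X) (tripleSum (blocks q))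
badCount-≤ q d j = begin
  badCount d (2 + j)
    ≡⟨ ∑-outcomes d (2 + j) _ ⟩
  ∑[ X ∈ Xs ] ∑ (choose 2 X) (pairSum λ v w → 𝟙 (not (isGood (X , v , w))))
    ≤⟨ ∑-mono-≤ Xs (∑-pairs-bad≤ q) ⟩
  ∑[ X ∈ Xs ] (∑ (choose 2 X) E + ∑ (choose 2 X) F + T₃ X)
    ≡⟨ trans (∑-distrib-+ Xs _ T₃) (cong (_+ ∑ Xs T₃) (∑-distrib-+ Xs _ _)) ⟩
  ∑[ X ∈ Xs ] ∑ (choose 2 X) E + ∑[ X ∈ Xs ] ∑ (choose 2 X) F + ∑ Xs T₃
    ≡⟨ cong₂ (λ e f → e + f + ∑ Xs T₃) (∑-choose-choose-cube 2 j d E) (∑-choose-choose-cube 2 j d F) ⟩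
  c * ∑ (choose 2 (cube d)) E + c * ∑ (choose 2 (cube d)) F + ∑ Xs T₃
    ≡⟨ cong (λ e → c * e + c * ∑ (choose 2 (cube d)) F + ∑ Xs T₃) (∑-pairs-cube-𝟙[v==w]≡0 d) ⟩
  c * 0 + c * ∑ (choose 2 (cube d)) F + ∑ Xs T₃
    ≤⟨ +-monoˡ-≤ (∑ Xs T₃) (+-mono-≤ (≤-reflexive (*-zeroʳ c))
                                      (*-monoʳ-≤ c (∑-pairs≤∑∑ _ (cube d)))) ⟩
  c * farPairs q d + ∑ Xs T₃ ∎
  where
  open ≤-Reasoning
  Xs = choose (2 + j) (cube d)
  c = (2 ^ d ∸ 2) C j
  E = pairSum λ v w → 𝟙 (v == w)
  F = pairSum λ v w → 𝟙 (far q v w)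
  T₃ = λ X → ∑ (choose 3 X) (tripleSum (blocks q))

∑-triples-≤ : ∀ q d i →
  ∑[ X ∈ choose (3 + i) (cube d) ] ∑ (choose 3 X) (tripleSum (blocks q)) ≤ ((2 ^ d ∸ 3) C i) * blockings q d
∑-triples-≤ q d i = begin
  ∑[ X ∈ choose (3 + i) (cube d) ] ∑ (choose 3 X) (tripleSum (blocks q))
    ≡⟨ ∑-choose-choose-cube 3 i d (tripleSum (blocks q)) ⟩
  c * ∑ (choose 3 (cube d)) (tripleSum (blocks q))
    ≡⟨ cong (c *_) (∑-pairs-∑-points≡∑-triples (blocks q) (blocks-v≡0 q) (blocks-w≡0 q) (cube d)) ⟨
  c * ∑[ Y ∈ choose 2 (cube d) ] ∑[ x ∈ cube d ] pairSum (λ v w → blocks q v w x) Y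
    ≤⟨ *-monoʳ-≤ c (∑-mono-≤ (choose 2 (cube d)) ∑-pairSum≤) ⟩
  c * ∑ (choose 2 (cube d)) (pairSum λ v w → ∑[ x ∈ cube d ] blocks q v w x)
    ≤⟨ *-monoʳ-≤ c (∑-pairs≤∑∑ _ (cube d)) ⟩
  c * blockings q d ∎
  where
  open ≤-Reasoning
  c = (2 ^ d ∸ 3) C i
  ∑-pairSum≤ : ∀ Y → ∑[ x ∈ cube d ] pairSum (λ v w → blocks q v w x) Y
                     ≤ pairSum (λ v w → ∑[ x ∈ cube d ] blocks q v w x) Y
  ∑-pairSum≤ []              = ≤-reflexive (∑-cube-zero d)
  ∑-pairSum≤ (v ∷ [])        = ≤-reflexive (∑-cube-zero d)
  ∑-pairSum≤ (v ∷ w ∷ [])    = ≤-refl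
  ∑-pairSum≤ (v ∷ w ∷ _ ∷ _) = ≤-reflexive (∑-cube-zero d)

-- Far and near pairs

far⇒d≤q*∣agreements-hamming∣ : ∀ q {d} (v w : Point d) → T (far q v w) →
  d ≤ q * ∣ agreements v w - hamming v w ∣
far⇒d≤q*∣agreements-hamming∣ q {d} v w isFar = begin
  d             ≤⟨ m+n≤o⇒m≤o∸n d (≤ᵇ⇒≤ _ _ isFar) ⟩
  q * D ∸ q * A ≡⟨ *-distribˡ-∸ q D A ⟨
  q * (D ∸ A)   ≤⟨ *-monoʳ-≤ q (m∸n≤∣m-n∣ D A) ⟩
  q * ∣ D - A ∣ ≡⟨ cong (q *_) (∣-∣-comm D A) ⟩
  q * ∣ A - D ∣ ∎
  where
  open ≤-Reasoning
  A = agreements v w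
  D = hamming v w

near⇒hamming*2q≤[q+1]*d : ∀ q {d} (v w : Point d) → far q v w ≡ false →
  hamming v w * (2 * q) ≤ (q + 1) * d
near⇒hamming*2q≤[q+1]*d q {d} v w near = begin
  D * (2 * q)         ≡⟨ double D q ⟩
  q * D + q * D       ≤⟨ +-monoˡ-≤ (q * D) (<⇒≤ (≰⇒> not-far)) ⟩
  d + q * A + q * D   ≡⟨ cong (λ n → n + q * A + q * D) (agreements+hamming≡d v w) ⟨
  (A + D) + q * A + q * D ≡⟨ collect q A D ⟩
  (q + 1) * (A + D)   ≡⟨ cong ((q + 1) *_) (agreements+hamming≡d v w) ⟩
  (q + 1) * d         ∎
  where
  open ≤-Reasoning
  A = agreements v w
  D = hamming v w
  not-far : ¬ (d + q * A ≤ q * D)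
  not-far d+qA≤qD = subst T near (≤⇒≤ᵇ d+qA≤qD)
  double : ∀ D q → D * (2 * q) ≡ q * D + q * D
  double = solve-∀
  collect : ∀ q A D → (A + D) + q * A + q * D ≡ (q + 1) * (A + D)
  collect = solve-∀

𝟙-far*d²≤ : ∀ q {d} (v w : Point d) →
  𝟙 (far q v w) * (d * d) ≤ q * q * (∣ agreements v w - hamming v w ∣ ^ 2)
𝟙-far*d²≤ q {d} v w with far q v w in farness
... | false = z≤n
... | true  = begin
  1 * (d * d)                         ≡⟨ *-identityˡ (d * d) ⟩
  d * d                               ≤⟨ *-mono-≤ d≤qx d≤qx ⟩
  q * ∣ A - D ∣ * (q * ∣ A - D ∣)     ≡⟨ regroup q ∣ A - D ∣ ⟩
  q * q * (∣ A - D ∣ ^ 2)             ∎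
  where
  open ≤-Reasoning
  A = agreements v w
  D = hamming v w
  d≤qx : d ≤ q * ∣ A - D ∣
  d≤qx = far⇒d≤q*∣agreements-hamming∣ q v w (subst T (sym farness) _)
  regroup : ∀ q x → q * x * (q * x) ≡ q * q * (x * (x * 1))
  regroup = solve-∀

farPairs*d²≤ : ∀ q d → farPairs q d * (d * d) ≤ q * q * (2 ^ d * (d * 2 ^ d))
farPairs*d²≤ q d = begin
  farPairs q d * (d * d)
    ≡⟨ *-comm (farPairs q d) (d * d) ⟩
  d * d * farPairs q d
    ≡⟨ ∑∑-*ˡ (cube d) (cube d) (d * d) (λ v w → 𝟙 (far q v w)) ⟨
  ∑[ v ∈ cube d ] ∑[ w ∈ cube d ] (d * d * 𝟙 (far q v w))
    ≤⟨ ∑-mono-≤ (cube d) (λ v → ∑-mono-≤ (cube d) λ w →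
         ≤-trans (≤-reflexive (*-comm (d * d) _)) (𝟙-far*d²≤ q v w)) ⟩
  ∑[ v ∈ cube d ] ∑[ w ∈ cube d ] (q * q * (∣ agreements v w - hamming v w ∣ ^ 2))
    ≡⟨ ∑∑-*ˡ (cube d) (cube d) (q * q) (λ v w → ∣ agreements v w - hamming v w ∣ ^ 2) ⟩
  q * q * ∑[ v ∈ cube d ] ∑[ w ∈ cube d ] (∣ agreements v w - hamming v w ∣ ^ 2)
    ≡⟨ cong (q * q *_) (trans (∑-cong (cube d) (∑-cube-∣agreements-hamming∣² d)) (∑-cube-const d _)) ⟩
  q * q * (2 ^ d * (d * 2 ^ d)) ∎
  where open ≤-Reasoning

blocks≤𝟙-near*𝟙-inFace : ∀ q {d} (v w x : Point d) →
  blocks q v w x ≤ 𝟙 (not (far q v w)) * 𝟙 (inFace v w x)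
blocks≤𝟙-near*𝟙-inFace q v w x with not (far q v w)
... | false = z≤n
... | true with inFace v w x
...   | true  = 𝟙≤1 _
...   | false rewrite ∨-zeroʳ (x == w) | ∨-zeroʳ (x == v) = z≤n

K*blockings≤ : ∀ q d K → (∀ (v w : Point d) → far q v w ≡ false → K * 2 ^ hamming v w ≤ 2 ^ d) →
  K * blockings q d ≤ 2 ^ d * (2 ^ d * 2 ^ d)
K*blockings≤ q d K near⇒K*2^h≤2^d = begin
  K * blockings q d
    ≡⟨ ∑∑-*ˡ (cube d) (cube d) K (λ v w → ∑[ x ∈ cube d ] blocks q v w x) ⟨
  ∑[ v ∈ cube d ] ∑[ w ∈ cube d ] (K * ∑[ x ∈ cube d ] blocks q v w x)
    ≤⟨ ∑-mono-≤ (cube d) (λ v → ∑-mono-≤ (cube d) (pair v)) ⟩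
  ∑[ v ∈ cube d ] ∑[ w ∈ cube d ] (2 ^ d)
    ≡⟨ trans (∑-cong (cube d) λ _ → ∑-cube-const d (2 ^ d)) (∑-cube-const d _) ⟩
  2 ^ d * (2 ^ d * 2 ^ d) ∎
  where
  open ≤-Reasoning
  ∑-blocks≤ : ∀ v w → ∑[ x ∈ cube d ] blocks q v w x ≤ 𝟙 (not (far q v w)) * 2 ^ hamming v w
  ∑-blocks≤ v w = begin
    ∑[ x ∈ cube d ] blocks q v w x
      ≤⟨ ∑-mono-≤ (cube d) (blocks≤𝟙-near*𝟙-inFace q v w) ⟩
    ∑[ x ∈ cube d ] (𝟙 (not (far q v w)) * 𝟙 (inFace v w x))
      ≡⟨ ∑-*ˡ (cube d) (𝟙 (not (far q v w))) _ ⟩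
    𝟙 (not (far q v w)) * ∑[ x ∈ cube d ] 𝟙 (inFace v w x)
      ≡⟨ cong (𝟙 (not (far q v w)) *_) (∑-cube-inFace d v w) ⟩
    𝟙 (not (far q v w)) * 2 ^ hamming v w ∎
  pair : ∀ v w → K * ∑[ x ∈ cube d ] blocks q v w x ≤ 2 ^ d
  pair v w with far q v w in farness | ∑-blocks≤ v w
  ... | true  | ∑≤0 = ≤-trans (*-monoʳ-≤ K ∑≤0) (≤-trans (≤-reflexive (*-zeroʳ K)) z≤n)
  ... | false | ∑≤2^h = ≤-trans (*-monoʳ-≤ K (≤-trans ∑≤2^h (≤-reflexive (+-identityʳ _))))
                                 (near⇒K*2^h≤2^d v w farness)

^-distribʳ-* : ∀ a b k → (a * b) ^ k ≡ a ^ k * b ^ k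
^-distribʳ-* a b zero    = refl
^-distribʳ-* a b (suc k) = trans (cong (a * b *_) (^-distribʳ-* a b k)) (interchange a b (a ^ k) (b ^ k))
  where
  interchange : ∀ a b x y → a * b * (x * y) ≡ a * x * (b * y)
  interchange = solve-∀

^-cancelʳ-≤ : ∀ k .{{_ : NonZero k}} {a b} → a ^ k ≤ b ^ k → a ≤ b
^-cancelʳ-≤ k aᵏ≤bᵏ = ≮⇒≥ λ b<a → <⇒≱ (^-monoˡ-< k b<a) aᵏ≤bᵏ

n<2^n : ∀ n → n < 2 ^ n
n<2^n zero    = z<s
n<2^n (suc n) =
  ≤-trans (+-mono-≤ (m^n>0 2 n) (n<2^n n)) (≤-reflexive (cong (2 ^ n +_) (sym (+-identityʳ (2 ^ n)))))

exponent-gap : ∀ p q → 1 ≤ p → 2 + (q ∸ 2 * p) + q ≤ 2 * q + (2 * p ∸ q)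
exponent-gap p q 1≤p with ≤-total (2 * p) q
... | inj₁ 2p≤q = begin
  2 + (q ∸ 2 * p) + q       ≤⟨ +-monoˡ-≤ q (+-monoˡ-≤ (q ∸ 2 * p) 2≤2p) ⟩
  2 * p + (q ∸ 2 * p) + q   ≡⟨ cong (_+ q) (m+[n∸m]≡n 2p≤q) ⟩
  q + q                     ≡⟨ double q ⟩
  2 * q + 0                 ≡⟨ cong (2 * q +_) (m≤n⇒m∸n≡0 2p≤q) ⟨
  2 * q + (2 * p ∸ q)       ∎
  where
  open ≤-Reasoning
  2≤2p = *-monoʳ-≤ 2 1≤p
  double : ∀ q → q + q ≡ 2 * q + 0
  double = solve-∀
... | inj₂ q≤2p = begin
  2 + (q ∸ 2 * p) + q       ≡⟨ cong (λ r → 2 + r + q) (m≤n⇒m∸n≡0 q≤2p) ⟩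
  2 + 0 + q                 ≤⟨ +-monoˡ-≤ q 2≤2p ⟩
  2 * p + q                 ≡⟨ cong (_+ q) (m+[n∸m]≡n q≤2p) ⟨
  q + (2 * p ∸ q) + q       ≡⟨ regroup q (2 * p ∸ q) ⟩
  2 * q + (2 * p ∸ q)       ∎
  where
  open ≤-Reasoning
  2≤2p = *-monoʳ-≤ 2 1≤p
  regroup : ∀ q r → q + r + q ≡ 2 * q + r
  regroup = solve-∀

K*n*2^h≤2^d : ∀ {p q d n K h} → 1 ≤ p → 1 ≤ q →
  n ^ (2 * q) * 2 ^ ((2 * p ∸ q) * d) ≤ 2 ^ ((q ∸ 2 * p) * d) →
  K ^ (2 * q) ≤ 2 ^ d → h * (2 * q) ≤ (q + 1) * d →
  K * n * 2 ^ h ≤ 2 ^ d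
K*n*2^h≤2^d {p} {q} {d} {n} {K} {h} 1≤p 1≤q nᵏe≤2^[r*d] Kᵏ≤2^d h*k≤[q+1]*d =
  ^-cancelʳ-≤ k (*-cancelʳ-≤ _ _ e (begin
    (K * n * 2 ^ h) ^ k * e
      ≡⟨ cong (_* e) (trans (^-distribʳ-* (K * n) (2 ^ h) k)
                            (cong₂ _*_ (^-distribʳ-* K n k) (^-*-assoc 2 h k))) ⟩
    K ^ k * n ^ k * 2 ^ (h * k) * e
      ≡⟨ regroup (K ^ k) (n ^ k) (2 ^ (h * k)) e ⟩
    K ^ k * (n ^ k * e) * 2 ^ (h * k)
      ≤⟨ *-mono-≤ (*-mono-≤ Kᵏ≤2^d nᵏe≤2^[r*d]) (^-monoʳ-≤ 2 h*k≤[q+1]*d) ⟩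
    2 ^ d * 2 ^ ((q ∸ 2 * p) * d) * 2 ^ ((q + 1) * d)
      ≡⟨ trans (^-distribˡ-+-* 2 (d + (q ∸ 2 * p) * d) _)
               (cong (_* 2 ^ ((q + 1) * d)) (^-distribˡ-+-* 2 d ((q ∸ 2 * p) * d))) ⟨
    2 ^ (d + (q ∸ 2 * p) * d + (q + 1) * d)
      ≡⟨ cong (2 ^_) (collect d (q ∸ 2 * p) q) ⟩
    2 ^ ((2 + (q ∸ 2 * p) + q) * d)
      ≤⟨ ^-monoʳ-≤ 2 (*-monoˡ-≤ d (exponent-gap p q 1≤p)) ⟩
    2 ^ ((2 * q + (2 * p ∸ q)) * d)
      ≡⟨ cong (2 ^_) (*-distribʳ-+ d (2 * q) (2 * p ∸ q)) ⟩
    2 ^ (2 * q * d + (2 * p ∸ q) * d)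
      ≡⟨ ^-distribˡ-+-* 2 (2 * q * d) _ ⟩
    2 ^ (2 * q * d) * e
      ≡⟨ cong (λ x → 2 ^ x * e) (*-comm k d) ⟩
    2 ^ (d * k) * e
      ≡⟨ cong (_* e) (^-*-assoc 2 d k) ⟨
    (2 ^ d) ^ k * e ∎))
  where
  open ≤-Reasoning
  k = 2 * q
  e = 2 ^ ((2 * p ∸ q) * d)
  instance
    k≢0 : NonZero k
    k≢0 = >-nonZero (≤-trans 1≤q (m≤n*m q 2))
    e≢0 : NonZero e
    e≢0 = >-nonZero (m^n>0 2 ((2 * p ∸ q) * d))
  regroup : ∀ a b c e → a * b * c * e ≡ a * (b * e) * c
  regroup = solve-∀
  collect : ∀ d r q → d + r * d + (q + 1) * d ≡ (2 + r + q) * d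
  collect = solve-∀

2P≡N*[N∸1] : ∀ {P m} → 2 * P + suc m ≡ suc m * suc m → 2 * P ≡ suc m * m
2P≡N*[N∸1] {P} {m} 2P+N≡N² =
  +-cancelʳ-≡ (suc m) _ _ (trans 2P+N≡N² (trans (*-suc (suc m) m) (+-comm (suc m) _)))

N²≤4P : ∀ {P N} → 2 * P + N ≡ N * N → 2 ≤ N → N * N ≤ 4 * P
N²≤4P {P} {suc (suc t)} 2P+N≡N² (s≤s (s≤s _)) = begin
  (2 + t) * (2 + t)                   ≤⟨ m≤m+n _ _ ⟩
  (2 + t) * (2 + t) + (2 + t) * t     ≡⟨ expand t ⟩
  2 * ((2 + t) * (1 + t))             ≡⟨ cong (2 *_) (2P≡N*[N∸1] {P} 2P+N≡N²) ⟨
  2 * (2 * P)                         ≡⟨ *-assoc 2 2 P ⟨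
  4 * P                               ∎
  where
  open ≤-Reasoning
  expand : ∀ t → (2 + t) * (2 + t) + (2 + t) * t ≡ 2 * ((2 + t) * (1 + t))
  expand = solve-∀

N³≤8[N∸2]P : ∀ {P N} → 2 * P + N ≡ N * N → 4 ≤ N → N * (N * N) ≤ 8 * ((N ∸ 2) * P)
N³≤8[N∸2]P {P} {suc (suc (suc (suc t)))} 2P+N≡N² (s≤s (s≤s (s≤s (s≤s _)))) = begin
  N * (N * N)                                     ≤⟨ m≤m+n _ _ ⟩
  N * (N * N) + N * (3 * t * t + 12 * t + 8)      ≡⟨ expand t ⟩
  4 * (2 + t) * (N * (3 + t))                     ≡⟨ cong (4 * (2 + t) *_) (2P≡N*[N∸1] {P} 2P+N≡N²) ⟨
  4 * (2 + t) * (2 * P)                           ≡⟨ regroup t P ⟩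
  8 * ((2 + t) * P)                               ∎
  where
  open ≤-Reasoning
  N = 4 + t
  expand : ∀ t → (4 + t) * ((4 + t) * (4 + t)) + (4 + t) * (3 * t * t + 12 * t + 8)
                 ≡ 4 * (2 + t) * ((4 + t) * (3 + t))
  expand = solve-∀
  regroup : ∀ t P → 4 * (2 + t) * (2 * P) ≡ 8 * ((2 + t) * P)
  regroup = solve-∀

halves : ∀ {M c F T P} → 2 * M * F ≤ P → 2 * M * T ≤ c * P → M * (c * F + T) ≤ c * P
halves {M} {c} {F} {T} {P} 2MF≤P 2MT≤cP = *-cancelˡ-≤ 2 (begin
  2 * (M * (c * F + T))          ≡⟨ distribute M c F T ⟩
  c * (2 * M * F) + 2 * M * T    ≤⟨ +-mono-≤ (*-monoʳ-≤ c 2MF≤P) 2MT≤cP ⟩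
  c * P + c * P                  ≡⟨ cong (c * P +_) (+-identityʳ (c * P)) ⟨
  2 * (c * P)                    ∎)
  where
  open ≤-Reasoning
  distribute : ∀ M c F T → 2 * (M * (c * F + T)) ≡ c * (2 * M * F) + 2 * M * T
  distribute = solve-∀

-- Few bad outcomes

-- From d ≥ 8Mq² far pairs, and from 2^d ≥ (16M)^(2q) blocked near pairs, are each at most a
-- fraction 1/(2M) of all outcomes.
threshold : ℕ → ℕ → ℕ
threshold M q = 8 * M * (q * q) + (16 * M) ^ (2 * q) + 2

module _ {M q d} (large : threshold M q ≤ d) where

  private
    8Mq²≤d : 8 * M * (q * q) ≤ d
    8Mq²≤d = ≤-trans (≤-trans (m≤m+n _ _) (m≤m+n _ 2)) large

    2≤d : 2 ≤ d
    2≤d = ≤-trans (m≤n+m 2 _) large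

    4≤2^d : 4 ≤ 2 ^ d
    4≤2^d = ^-monoʳ-≤ 2 2≤d

    2≤2^d : 2 ≤ 2 ^ d
    2≤2^d = ≤-trans (s≤s (s≤s z≤n)) 4≤2^d

    2P+N≡N² : 2 * pairs d + 2 ^ d ≡ 2 ^ d * 2 ^ d
    2P+N≡N² = 2*pairs+2^d≡2^d*2^d d

  [16M]^2q≤2^d : (16 * M) ^ (2 * q) ≤ 2 ^ d
  [16M]^2q≤2^d =
    ≤-trans (≤-trans (≤-trans (m≤n+m _ (8 * M * (q * q))) (m≤m+n _ 2)) large) (<⇒≤ (n<2^n d))

  M*badCount≤ : ∀ {n} → n < 2 → M * badCount d n ≤ length (outcomes d n)
  M*badCount≤ n<2 = ≤-trans (≤-reflexive (trans (cong (M *_) (badCount-<2 d n<2)) (*-zeroʳ M))) z≤n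

  2M*farPairs≤pairs : 2 * M * farPairs q d ≤ pairs d
  2M*farPairs≤pairs = *-cancelˡ-≤ d {{>-nonZero (≤-trans (s≤s z≤n) 2≤d)}} (begin
    d * (2 * M * F)               ≡⟨ regroup d M F ⟩
    2 * M * (F * d)               ≤⟨ *-monoʳ-≤ (2 * M) F*d≤q²N² ⟩
    2 * M * (q * q * (N * N))     ≤⟨ *-monoʳ-≤ (2 * M) (*-monoʳ-≤ (q * q) (N²≤4P {P} 2P+N≡N² 2≤2^d)) ⟩
    2 * M * (q * q * (4 * P))     ≡⟨ regroup′ M q P ⟩
    8 * M * (q * q) * P           ≤⟨ *-monoˡ-≤ P 8Mq²≤d ⟩
    d * P                         ∎)
    where
    open ≤-Reasoning
    N = 2 ^ d
    F = farPairs q d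
    P = pairs d
    regroup″ : ∀ q N d → q * q * (N * (d * N)) ≡ q * q * (N * N) * d
    regroup″ = solve-∀
    F*d≤q²N² : F * d ≤ q * q * (N * N)
    F*d≤q²N² = *-cancelʳ-≤ (F * d) _ d {{>-nonZero (≤-trans (s≤s z≤n) 2≤d)}} (begin
      F * d * d              ≡⟨ *-assoc F d d ⟩
      F * (d * d)            ≤⟨ farPairs*d²≤ q d ⟩
      q * q * (N * (d * N))  ≡⟨ regroup″ q N d ⟩
      q * q * (N * N) * d    ∎)
    regroup : ∀ d M F → d * (2 * M * F) ≡ 2 * M * (F * d)
    regroup = solve-∀
    regroup′ : ∀ M q P → 2 * M * (q * q * (4 * P)) ≡ 8 * M * (q * q) * P
    regroup′ = solve-∀

  2M[1+i]*blockings≤[N∸2]*pairs : ∀ i →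
    (∀ (v w : Point d) → far q v w ≡ false → 16 * M * (3 + i) * 2 ^ hamming v w ≤ 2 ^ d) →
    2 * M * suc i * blockings q d ≤ (2 ^ d ∸ 2) * pairs d
  2M[1+i]*blockings≤[N∸2]*pairs i near⇒K*2^h≤2^d = *-cancelˡ-≤ 16 (begin
    16 * (2 * M * suc i * H)       ≡⟨ regroup M (suc i) H ⟩
    2 * (16 * M * suc i * H)       ≤⟨ *-monoʳ-≤ 2 (*-monoˡ-≤ H (*-monoʳ-≤ (16 * M) 1+i≤3+i)) ⟩
    2 * (16 * M * (3 + i) * H)     ≤⟨ *-monoʳ-≤ 2 (K*blockings≤ q d (16 * M * (3 + i)) near⇒K*2^h≤2^d) ⟩
    2 * (N * (N * N))              ≤⟨ *-monoʳ-≤ 2 (N³≤8[N∸2]P {P} 2P+N≡N² 4≤2^d) ⟩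
    2 * (8 * ((N ∸ 2) * P))        ≡⟨ *-assoc 2 8 ((N ∸ 2) * P) ⟨
    16 * ((N ∸ 2) * P)             ∎)
    where
    open ≤-Reasoning
    N = 2 ^ d
    P = pairs d
    H = blockings q d
    1+i≤3+i : 1 + i ≤ 3 + i
    1+i≤3+i = +-monoˡ-≤ i (s≤s z≤n)
    regroup : ∀ M j H → 16 * (2 * M * j * H) ≡ 2 * (16 * M * j * H)
    regroup = solve-∀

  2M*triples≤ : ∀ {p} j → 1 ≤ p → 1 ≤ q →
    (2 + j) ^ (2 * q) * 2 ^ ((2 * p ∸ q) * d) ≤ 2 ^ ((q ∸ 2 * p) * d) →
    2 * M * ∑[ X ∈ choose (2 + j) (cube d) ] ∑ (choose 3 X) (tripleSum (blocks q)) ≤ ((2 ^ d ∸ 2) C j) * pairs d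
  2M*triples≤ zero    _   _   _ = ≤-trans (≤-reflexive (trans (cong (2 * M *_) no-triples) (*-zeroʳ (2 * M)))) z≤n
    where
    no-triples : ∑[ X ∈ choose 2 (cube d) ] ∑ (choose 3 X) (tripleSum (blocks q)) ≡ 0
    no-triples = m<k⇒∑-choose-choose≡0 {m = 2} ≤-refl (cube d) (λ _ → tripleSum (blocks q))
  2M*triples≤ (suc i) 1≤p 1≤q n-upper = *-cancelˡ-≤ (suc i) (begin
    suc i * (2 * M * T₃)           ≤⟨ *-monoʳ-≤ (suc i) (*-monoʳ-≤ (2 * M) (∑-triples-≤ q d i)) ⟩
    suc i * (2 * M * (c₃ * H))     ≡⟨ regroup (suc i) M c₃ H ⟩
    c₃ * (2 * M * suc i * H)       ≤⟨ *-monoʳ-≤ c₃ (2M[1+i]*blockings≤[N∸2]*pairs i near⇒K*2^h≤2^d) ⟩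
    c₃ * ((N ∸ 2) * P)             ≡⟨ regroup′ c₃ (N ∸ 2) P ⟩
    ((N ∸ 2) * c₃) * P             ≡⟨ cong (_* P) absorption ⟨
    (c₂ * suc i) * P               ≡⟨ regroup″ c₂ (suc i) P ⟩
    suc i * (c₂ * P)               ∎)
    where
    open ≤-Reasoning
    N = 2 ^ d
    P = pairs d
    H = blockings q d
    T₃ = ∑[ X ∈ choose (3 + i) (cube d) ] ∑ (choose 3 X) (tripleSum (blocks q))
    c₂ = (N ∸ 2) C suc i
    c₃ = (N ∸ 3) C i
    absorption : c₂ * suc i ≡ (N ∸ 2) * c₃
    absorption = subst (λ m → (m C suc i) * suc i ≡ m * c₃)
                       (sym (+-∸-assoc 1 (≤-trans (n≤1+n 3) 4≤2^d)))
                       ([1+n]C[1+k]*[1+k]≡[1+n]*nCk (N ∸ 3) i)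
    regroup : ∀ j M c H → j * (2 * M * (c * H)) ≡ c * (2 * M * j * H)
    regroup = solve-∀
    regroup′ : ∀ c m P → c * (m * P) ≡ (m * c) * P
    regroup′ = solve-∀
    regroup″ : ∀ c j P → (c * j) * P ≡ j * (c * P)
    regroup″ = solve-∀
    near⇒K*2^h≤2^d : ∀ (v w : Point d) → far q v w ≡ false → 16 * M * (3 + i) * 2 ^ hamming v w ≤ 2 ^ d
    near⇒K*2^h≤2^d v w near =
      K*n*2^h≤2^d {d = d} {K = 16 * M} {h = hamming v w} 1≤p 1≤q n-upper [16M]^2q≤2^d
                  (near⇒hamming*2q≤[q+1]*d q v w near)

  few-bad-outcomes : ∀ {p n} → 1 ≤ p → 1 ≤ q → IsFloorExp p q d n → M * badCount d n ≤ length (outcomes d n)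
  few-bad-outcomes {n = zero}        _   _   _ = M*badCount≤ (s≤s z≤n)
  few-bad-outcomes {n = suc zero}    _   _   _ = M*badCount≤ (s≤s (s≤s z≤n))
  few-bad-outcomes {n = suc (suc j)} 1≤p 1≤q (n-upper , _) = begin
    M * badCount d (2 + j)
      ≤⟨ *-monoʳ-≤ M (badCount-≤ q d j) ⟩
    M * (((2 ^ d ∸ 2) C j) * farPairs q d + _)
      ≤⟨ halves {M} {(2 ^ d ∸ 2) C j} 2M*farPairs≤pairs (2M*triples≤ j 1≤p 1≤q n-upper) ⟩
    ((2 ^ d ∸ 2) C j) * pairs d
      ≡⟨ length-outcomes d j ⟨
    length (outcomes d (2 + j)) ∎
    where open ≤-Reasoning

-- Probabilities

ℕtoℚ≡mkℚ : ∀ n → ℕtoℚ n ≡ mkℚ (pos n) 0 (coprime-sym (1-coprimeTo n))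
ℕtoℚ≡mkℚ n = Q.normalize-coprime (coprime-sym (1-coprimeTo n))

ℕtoℚ-+ : ∀ m n → ℕtoℚ (m + n) ≡ ℕtoℚ m Q.+ ℕtoℚ n
ℕtoℚ-+ m n =
  trans (cong (λ i → i Q./ 1) pos[m+n]≡m*1+n*1) (sym (cong₂ Q._+_ (ℕtoℚ≡mkℚ m) (ℕtoℚ≡mkℚ n)))
  where
  pos[m+n]≡m*1+n*1 : pos (m + n) ≡ pos m ℤ.* pos 1 ℤ.+ pos n ℤ.* pos 1
  pos[m+n]≡m*1+n*1 = trans (ℤ.pos-+ m n) (sym (cong₂ ℤ._+_ (ℤ.*-identityʳ (pos m)) (ℤ.*-identityʳ (pos n))))

ℕtoℚ-* : ∀ m n → ℕtoℚ (m * n) ≡ ℕtoℚ m Q.* ℕtoℚ n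
ℕtoℚ-* m n =
  trans (cong (λ i → i Q./ 1) (ℤ.pos-* m n)) (sym (cong₂ Q._*_ (ℕtoℚ≡mkℚ m) (ℕtoℚ≡mkℚ n)))

ℕtoℚ-mono-≤ : ∀ {m n} → m ≤ n → ℕtoℚ m Q.≤ ℕtoℚ n
ℕtoℚ-mono-≤ {m} {n} m≤n rewrite ℕtoℚ≡mkℚ m | ℕtoℚ≡mkℚ n =
  Q.*≤* (ℤ.*-monoʳ-≤-nonNeg (pos 1) (ℤ.+≤+ m≤n))

archimedean : ∀ δ → 0ℚ Q.< δ → ∃ λ M → 1ℚ Q.≤ δ Q.* ℕtoℚ M
archimedean δ@(mkℚ +[1+ a ] b _) _ = suc b , 1≤δ*[1+b]
  where
  1≤δ*[1+b] : 1ℚ Q.≤ δ Q.* ℕtoℚ (suc b)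
  1≤δ*[1+b] rewrite ℕtoℚ≡mkℚ (suc b) = Q.toℚᵘ-cancel-≤
    (ℚᵘ.≤-respʳ-≃ (ℚᵘ.≃-sym (Q.toℚᵘ-homo-* δ 1+b)) (ℚᵘ.*≤* (ℤ.+≤+ 1+b≤[1+a]*[1+b])))
    where
    1+b = mkℚ (pos (suc b)) 0 (coprime-sym (1-coprimeTo (suc b)))
    1+b≤[1+a]*[1+b] : 1 * suc (b * 1) ≤ (suc a * suc b) * 1
    1+b≤[1+a]*[1+b] = ≤-trans (≤-reflexive (cong suc (trans (+-identityʳ (b * 1)) (*-identityʳ b))))
                              (≤-trans (m≤n*m (suc b) (suc a)) (≤-reflexive (sym (*-identityʳ _))))
archimedean (mkℚ (pos zero) _ _) (Q.*<* (ℤ.+<+ ()))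
archimedean (mkℚ -[1+ _ ] _ _) (Q.*<* ())

[1-δ]*[g+b]≤g : ∀ {δ M} g b → 0ℚ Q.< δ → 1ℚ Q.≤ δ Q.* ℕtoℚ M → M * b ≤ g + b →
  (1ℚ - δ) Q.* ℕtoℚ (g + b) Q.≤ ℕtoℚ g
[1-δ]*[g+b]≤g {δ} {M} g b 0<δ 1≤δM Mb≤g+b = begin
  (1ℚ - δ) Q.* ℕtoℚ (g + b)         ≡⟨ distribute δ (ℕtoℚ (g + b)) ⟩
  ℕtoℚ (g + b) - δ Q.* ℕtoℚ (g + b) ≤⟨ Q.+-monoʳ-≤ (ℕtoℚ (g + b)) (Q.neg-antimono-≤ b≤δ[g+b]) ⟩
  ℕtoℚ (g + b) - ℕtoℚ b             ≡⟨ cong (_- ℕtoℚ b) (ℕtoℚ-+ g b) ⟩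
  (ℕtoℚ g Q.+ ℕtoℚ b) - ℕtoℚ b      ≡⟨ cancel (ℕtoℚ g) (ℕtoℚ b) ⟩
  ℕtoℚ g                            ∎
  where
  open Q.≤-Reasoning
  open +-*-Solver
  distribute : ∀ δ t → (1ℚ - δ) Q.* t ≡ t - δ Q.* t
  distribute = solve 2 (λ δ t → (con 1ℚ :- δ) :* t := t :- δ :* t) refl
  cancel : ∀ g b → (g Q.+ b) - b ≡ g
  cancel = solve 2 (λ g b → (g :+ b) :- b := g) refl
  instance
    b≥0 : Q.NonNegative (ℕtoℚ b)
    b≥0 = Q.nonNegative (ℕtoℚ-mono-≤ (z≤n {b}))
    δ≥0 : Q.NonNegative δ
    δ≥0 = Q.nonNegative (Q.<⇒≤ 0<δ)
  b≤δ[g+b] : ℕtoℚ b Q.≤ δ Q.* ℕtoℚ (g + b)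
  b≤δ[g+b] = begin
    ℕtoℚ b                     ≡⟨ Q.*-identityˡ (ℕtoℚ b) ⟨
    1ℚ Q.* ℕtoℚ b              ≤⟨ Q.*-monoʳ-≤-nonNeg (ℕtoℚ b) 1≤δM ⟩
    δ Q.* ℕtoℚ M Q.* ℕtoℚ b    ≡⟨ Q.*-assoc δ (ℕtoℚ M) (ℕtoℚ b) ⟩
    δ Q.* (ℕtoℚ M Q.* ℕtoℚ b)  ≡⟨ cong (δ Q.*_) (ℕtoℚ-* M b) ⟨
    δ Q.* ℕtoℚ (M * b)         ≤⟨ Q.*-monoˡ-≤-nonNeg δ (ℕtoℚ-mono-≤ Mb≤g+b) ⟩
    δ Q.* ℕtoℚ (g + b)         ∎

few-bad⇒πAtLeast : ∀ {d n M δ} → 0ℚ Q.< δ → 1ℚ Q.≤ δ Q.* ℕtoℚ M →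
  M * badCount d n ≤ length (outcomes d n) → πAtLeast d n (1ℚ - δ)
few-bad⇒πAtLeast {d} {n} {M} {δ} 0<δ 1≤δM M*bad≤|os| =
  good , filter-⊆ (T? ∘ isGood {d}) os ,
  All.map (λ {o} → isGood⇒EdgeOutcome o) (All.all-filter (T? ∘ isGood {d}) os) ,
  subst (λ L → (1ℚ - δ) Q.* ℕtoℚ L Q.≤ ℕtoℚ (length good)) |good|+bad≡|os|
        ([1-δ]*[g+b]≤g {δ} {M} (length good) (badCount d n) 0<δ 1≤δM
                       (subst (M * badCount d n ≤_) (sym |good|+bad≡|os|) M*bad≤|os|))
  where
  os = outcomes d n
  good = filterᵇ isGood os
  |good|+bad≡|os| : length good + badCount d n ≡ length os
  |good|+bad≡|os| = length-filterᵇ+∑-rejected isGood os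

proposition4 : (p q : ℕ) → 0 < p → 0 < q → (δ : ℚ) → 0ℚ Q.< δ →
    ∃ λ D → (d : ℕ) → D ≤ d → (n : ℕ) → IsFloorExp p q d n →
      πAtLeast d n (1ℚ - δ)
proposition4 p q 0<p 0<q δ 0<δ with archimedean δ 0<δ
... | M , 1≤δM = threshold M q , λ d large n floor →
  few-bad⇒πAtLeast {d} {n} {M} 0<δ 1≤δM (few-bad-outcomes {M} large 0<p 0<q floor)
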